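{- Let $t,n,d$ be positive integers with $t\ge2$, $d\not\equiv0\pmod{t^n-1}$, and $d\not\equiv1\pmod{t-1}$. Then there exist nonzero $a,b\in\mathbb{Z}/(t^n-1)\mathbb{Z}$ such that $a\prec b$ and $db\prec da$.
   Context: For $a\in\mathbb{Z}/(t^n-1)\mathbb{Z}$, the standard $t$-ary expansion is $a=a_0+a_1t+\cdots+a_{n-1}t^{n-1}$ in $\mathbb{Z}/(t^n-1)\mathbb{Z}$ with integers $0\le a_i<t$, where all $a_i=0$ when $a=0$ (this makes the digits unique). For $a,b$ with standard expansions having digits $a_i,b_i$, write $a\preceq b$ ("$b$ covers $a$") if $a_i\le b_i$ for all $i$, and $a\prec b$ if $a\preceq b$ and $a\ne b$. -}

module Defs where

open import Data.Nat using (ℕ; zero; suc; _*_; _∸_; _^_; _≤_)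
open import Data.Nat.DivMod using (_%_; _/_)
open import Data.Fin using (Fin; toℕ)
open import Data.Product using (_×_)
open import Relation.Binary.PropositionalEquality using (_≡_)
open import Relation.Nullary using (¬_)

-- x mod m, with the convention x mod 0 = x (so congruence mod 0 is equality)
_mod_ : ℕ → ℕ → ℕ
x mod zero    = x
x mod (suc k) = x % suc k

_≡_[mod_] : ℕ → ℕ → ℕ → Set
a ≡ b [mod m ] = a mod m ≡ b mod m

-- Elements of ℤ/(t^n-1)ℤ are represented by their canonical residues
-- r ∈ {0, …, t^n-2}; reduction of a natural number to its canonical residue:
red : (t n x : ℕ) → ℕ
red t n x = x mod (t ^ n ∸ 1)

digit : (t r i : ℕ) → ℕ
digit zero    r i       = 0
digit (suc k) r zero    = r % suc k
digit (suc k) r (suc i) = digit (suc k) (r / suc k) i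

-- For a canonical residue r < t^n - 1, its n base-t digits form exactly the
-- standard t-ary expansion (digits of 0 are all 0; the all-(t-1) word is excluded).
-- a ⪯ b : b covers a
_⪯⟨_,_⟩_ : ℕ → ℕ → ℕ → ℕ → Set
a ⪯⟨ t , n ⟩ b = (i : Fin n) → digit t a (toℕ i) ≤ digit t b (toℕ i)

_≺⟨_,_⟩_ : ℕ → ℕ → ℕ → ℕ → Set
a ≺⟨ t , n ⟩ b = (a ⪯⟨ t , n ⟩ b) × ¬ (a ≡ b)

module Submission where

-- Write t = p + 1 (so p = t - 1 ≥ 1) and let R = 1 + t + ⋯ + t^(n-1) be the
-- base-t repunit, so that t^n - 1 = p·R.  For 0 ≤ c < t the number c·R is the
-- "constant word" all of whose n base-t digits equal c, and multiplication by
-- d acts on constant words through residues modulo p: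
--     d·(c·R) ≡ ((d·c) mod p)·R   (mod p·R).
-- Hence it suffices to find 1 ≤ c₁ < c₂ < p with (d·c₂) mod p < (d·c₁) mod p;
-- then a = c₁·R, b = c₂·R work, since constant words are ordered by ⪯ exactly
-- as their digits.  With D = d mod p (D ≠ 1 by hypothesis) there are two cases.
--   * D ≥ 2: for q = ⌊(p-1)/D⌋ we have q·D < p ≤ (q+1)·D < 2p, so the multiple
--     (q+1)·D wraps around modulo p and lands below q·D ("wraparound").
--   * D = 0: then d·R ≡ 0 while d·1 ≢ 0 (mod t^n - 1); this forces n ≥ 2 and
--     the pair a = 1, b = R works, since every digit of 1 is at most 1.
-- The file first develops repunits and digits, then the two cases, and finally
-- assembles the theorem.

open import Defs
open import Data.Nat using (ℕ; zero; suc; _+_; _*_; _∸_; _^_; _≤_; _<_; z≤n; s≤s; NonZero; >-nonZero)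
open import Data.Nat.Properties
open import Data.Nat.DivMod
  using (_%_; _/_; m%n<n; m<n⇒m%n≡m; m≤n⇒[n∸m]%m≡n%m; m≡m%n+[m/n]*n; [m+kn]%n≡m%n;
         +-distrib-/-∣ʳ; m<n⇒m/n≡0; m*n/n≡m; m/n*n≤m; m≥n⇒m/n>0; m%n*o≡m*o%[n*o];
         %-distribˡ-*; n%1≡0)
open import Data.Nat.Divisibility using (divides-refl)
open import Data.Nat.Tactic.RingSolver using (solve-∀)
open import Data.Fin using (Fin; toℕ) renaming (zero to fzero; suc to fsuc)
open import Data.Product using (Σ; _×_; _,_)
open import Data.Empty using (⊥-elim)
open import Relation.Binary.PropositionalEquality
  using (_≡_; _≢_; refl; sym; trans; cong; cong₂; subst; subst₂; module ≡-Reasoning)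
open import Relation.Nullary using (¬_)

ReversedPair : ℕ → ℕ → ℕ → Set
ReversedPair t n d = Σ ℕ λ a → Σ ℕ λ b →
  (a < t ^ n ∸ 1) × (b < t ^ n ∸ 1) × ¬ (a ≡ 0) × ¬ (b ≡ 0) ×
  (a ≺⟨ t , n ⟩ b) × (red t n (d * b) ≺⟨ t , n ⟩ red t n (d * a))

rep : ℕ → ℕ → ℕ
rep t zero    = 0
rep t (suc n) = suc (rep t n * t)

pow≡1+*rep : ∀ p n → suc p ^ n ≡ suc (p * rep (suc p) n)
pow≡1+*rep p zero    = cong suc (sym (*-zeroʳ p))
pow≡1+*rep p (suc n) = trans (cong (suc p *_) (pow≡1+*rep p n)) (horner p (rep (suc p) n))
  where
  horner : ∀ p r → suc p * suc (p * r) ≡ suc (p * suc (r * suc p))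
  horner = solve-∀

pow∸1≡*rep : ∀ p n → suc p ^ n ∸ 1 ≡ p * rep (suc p) n
pow∸1≡*rep p n = cong (_∸ 1) (pow≡1+*rep p n)

*-mod-*ʳ : ∀ x m k → (x * suc k) mod (m * suc k) ≡ (x mod m) * suc k
*-mod-*ʳ x zero    k = refl
*-mod-*ʳ x (suc m) k = sym (m%n*o≡m*o%[n*o] x (suc m) (suc k))

red-*-word : ∀ p n d c →
  red (suc p) (suc n) (d * (c * rep (suc p) (suc n))) ≡ ((d * c) mod p) * rep (suc p) (suc n)
red-*-word p n d c = begin
  red (suc p) (suc n) (d * (c * R))  ≡⟨ cong (_mod (suc p ^ suc n ∸ 1)) (sym (*-assoc d c R)) ⟩
  red (suc p) (suc n) (d * c * R)    ≡⟨ cong ((d * c * R) mod_) (pow∸1≡*rep p (suc n)) ⟩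
  (d * c * R) mod (p * R)            ≡⟨ *-mod-*ʳ (d * c) p (rep (suc p) n * suc p) ⟩
  ((d * c) mod p) * R                ∎
  where
  open ≡-Reasoning
  R = rep (suc p) (suc n)

zero-mod : ∀ m → 0 mod m ≡ 0
zero-mod zero    = refl
zero-mod (suc m) = refl

word<modulus : ∀ p n c → c < p → c * rep (suc p) (suc n) < suc p ^ suc n ∸ 1
word<modulus p n c c<p =
  subst (c * R <_) (sym (pow∸1≡*rep p (suc n))) (*-monoˡ-< R c<p)
  where R = rep (suc p) (suc n)

digit-head : ∀ p c y → c < suc p → digit (suc p) (c + y * suc p) 0 ≡ c
digit-head p c y c<t = trans ([m+kn]%n≡m%n c y (suc p)) (m<n⇒m%n≡m c<t)

digit-tail : ∀ p c y i → c < suc p → digit (suc p) (c + y * suc p) (suc i) ≡ digit (suc p) y i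
digit-tail p c y i c<t = cong (λ z → digit (suc p) z i) quotient
  where
  open ≡-Reasoning
  quotient : (c + y * suc p) / suc p ≡ y
  quotient = begin
    (c + y * suc p) / suc p          ≡⟨ +-distrib-/-∣ʳ c (divides-refl y) ⟩
    c / suc p + y * suc p / suc p    ≡⟨ cong₂ _+_ (m<n⇒m/n≡0 c<t) (m*n/n≡m y (suc p)) ⟩
    0 + y                            ∎

digit-word : ∀ p c n (i : Fin n) → c < suc p → digit (suc p) (c * rep (suc p) n) (toℕ i) ≡ c
digit-word p c (suc n) i c<t =
  trans (cong (λ x → digit (suc p) x (toℕ i)) horner-step) (by-position i)
  where
  r = c * rep (suc p) n
  horner-step : c * rep (suc p) (suc n) ≡ c + r * suc p
  horner-step = trans (*-suc c _) (cong (c +_) (sym (*-assoc c (rep (suc p) n) (suc p))))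
  by-position : (i : Fin (suc n)) → digit (suc p) (c + r * suc p) (toℕ i) ≡ c
  by-position fzero    = digit-head p c r c<t
  by-position (fsuc j) = trans (digit-tail p c r (toℕ j) c<t) (digit-word p c n j c<t)

digit-zero : ∀ p j → digit (suc p) 0 j ≡ 0
digit-zero p zero    = refl
digit-zero p (suc j) = digit-zero p j

digit-one : ∀ p j → digit (suc (suc p)) 1 j ≤ 1
digit-one p zero    = s≤s z≤n
digit-one p (suc j) = subst (_≤ 1) (sym (digit-zero (suc p) j)) z≤n

word-≺ : ∀ p n c₁ c₂ → c₁ < c₂ → c₂ < suc p →
  (c₁ * rep (suc p) (suc n)) ≺⟨ suc p , suc n ⟩ (c₂ * rep (suc p) (suc n))
word-≺ p n c₁ c₂ c₁<c₂ c₂<t = covered , distinct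
  where
  R = rep (suc p) (suc n)
  covered : (c₁ * R) ⪯⟨ suc p , suc n ⟩ (c₂ * R)
  covered i = subst₂ _≤_ (sym (digit-word p c₁ (suc n) i (<-trans c₁<c₂ c₂<t)))
                         (sym (digit-word p c₂ (suc n) i c₂<t)) (<⇒≤ c₁<c₂)
  distinct : c₁ * R ≢ c₂ * R
  distinct eq = <⇒≢ c₁<c₂ (*-cancelʳ-≡ c₁ c₂ R eq)

zero-≺ : ∀ p n x → x ≢ 0 → 0 ≺⟨ suc p , n ⟩ x
zero-≺ p n x x≢0 = (λ i → subst (_≤ digit (suc p) x (toℕ i)) (sym (digit-zero p (toℕ i))) z≤n) , (λ eq → x≢0 (sym eq))

one-≺-rep : ∀ p n → 1 ≺⟨ suc (suc p) , suc (suc n) ⟩ (1 * rep (suc (suc p)) (suc (suc n)))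
one-≺-rep p n = covered , (λ ())
  where
  covered : 1 ⪯⟨ suc (suc p) , suc (suc n) ⟩ (1 * rep (suc (suc p)) (suc (suc n)))
  covered i = subst (digit (suc (suc p)) 1 (toℕ i) ≤_)
                    (sym (digit-word (suc p) 1 (suc (suc n)) i (s≤s (s≤s z≤n))))
                    (digit-one p (toℕ i))

reversed-residues : ∀ p n d c₁ c₂ → 1 ≤ c₁ → c₁ < c₂ → c₂ < suc p →
  (d * c₂) % suc p < (d * c₁) % suc p → ReversedPair (suc (suc p)) (suc n) d
reversed-residues p n d c₁ c₂ 1≤c₁ c₁<c₂ c₂<p reversed =
  c₁ * R , c₂ * R ,
  word<modulus (suc p) n c₁ (<-trans c₁<c₂ c₂<p) , word<modulus (suc p) n c₂ c₂<p ,
  nonzero c₁ 1≤c₁ , nonzero c₂ (≤-trans 1≤c₁ (<⇒≤ c₁<c₂)) ,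
  word-≺ (suc p) n c₁ c₂ c₁<c₂ (m<n⇒m<1+n c₂<p) ,
  subst₂ (λ x y → x ≺⟨ suc (suc p) , suc n ⟩ y)
         (sym (red-*-word (suc p) n d c₂)) (sym (red-*-word (suc p) n d c₁))
         (word-≺ (suc p) n _ _ reversed (m<n⇒m<1+n (m%n<n (d * c₁) (suc p))))
  where
  R = rep (suc (suc p)) (suc n)
  nonzero : ∀ c → 1 ≤ c → c * R ≢ 0
  nonzero c 1≤c eq = <⇒≢ 1≤c (sym (m*n≡0⇒m≡0 c R eq))

-- Multiplication by D on ℤ/(K+1) with 2 ≤ D ≤ K is not monotone: for
-- q = ⌊K/D⌋ we have q·D ≤ K < (q+1)·D < 2(K+1), so (q+1)·D wraps around
-- to (q+1)·D - (K+1), which lies below q·D.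
wraparound : ∀ K D → 2 ≤ D → D ≤ K →
  Σ ℕ λ c → 1 ≤ c × suc c < suc K × (suc c * D) % suc K < (c * D) % suc K
wraparound K (suc zero) (s≤s ()) _
wraparound K D@(suc (suc _)) _ D≤K = q , 1≤q , q+1<P , wraps
  where
  P = suc K
  q = K / D
  1≤q : 1 ≤ q
  1≤q = m≥n⇒m/n>0 D≤K
  qD≤K : q * D ≤ K
  qD≤K = m/n*n≤m K D
  q+1<P : suc q < P
  q+1<P = s≤s (<-≤-trans (m<m*n q D {{>-nonZero 1≤q}} (s≤s (s≤s z≤n))) qD≤K)
  P≤[q+1]D : P ≤ D + q * D
  P≤[q+1]D = subst (λ k → suc k ≤ D + q * D) (sym (m≡m%n+[m/n]*n K D))
                   (+-monoˡ-< (q * D) (m%n<n K D))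
  ∸-bound : ∀ a b → a < P + b → P ≤ a → a ∸ P < b
  ∸-bound a b a<P+b P≤a = subst (a ∸ P <_) (m+n∸m≡n P b) (∸-monoˡ-< a<P+b P≤a)
  wraps : (suc q * D) % P < (q * D) % P
  wraps = begin-strict
    (D + q * D) % P      ≡⟨ m≤n⇒[n∸m]%m≡n%m P≤[q+1]D ⟨
    (D + q * D ∸ P) % P  ≡⟨ m<n⇒m%n≡m (∸-bound _ P (+-mono-< (s≤s D≤K) (s≤s qD≤K)) P≤[q+1]D) ⟩
    D + q * D ∸ P        <⟨ ∸-bound _ (q * D) (+-monoˡ-< (q * D) (s≤s D≤K)) P≤[q+1]D ⟩
    q * D                ≡⟨ m<n⇒m%n≡m (s≤s qD≤K) ⟨
    (q * D) % P          ∎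
    where open ≤-Reasoning

*-residue : ∀ P d c .{{_ : NonZero P}} → c < P → (d * c) % P ≡ (c * (d % P)) % P
*-residue P d c c<P = begin
  (d * c) % P                ≡⟨ %-distribˡ-* d c P ⟩
  ((d % P) * (c % P)) % P    ≡⟨ cong (λ r → ((d % P) * r) % P) (m<n⇒m%n≡m c<P) ⟩
  ((d % P) * c) % P          ≡⟨ cong (_% P) (*-comm (d % P) c) ⟩
  (c * (d % P)) % P          ∎
  where open ≡-Reasoning

nondivisible-case : ∀ p n d → 2 ≤ d % suc p → ReversedPair (suc (suc p)) (suc n) d
nondivisible-case p n d 2≤D
  with (c , 1≤c , c+1<P , wraps) ← wraparound p (d % suc p) 2≤D (≤-pred (m%n<n d (suc p)))
  = reversed-residues p n d c (suc c) 1≤c (n<1+n c) c+1<P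
      (subst₂ _<_ (sym (*-residue (suc p) d (suc c) c+1<P))
                  (sym (*-residue (suc p) d c (<-trans (n<1+n c) c+1<P))) wraps)

-- Case d ≡ 0 mod (t-1): the pair a = 1, b = R, which needs n ≥ 2; for n = 1
-- the modulus is t - 1 itself and d ≡ 0 would contradict the hypothesis.
divisible-case : ∀ p n d → d % suc (suc p) ≡ 0 →
  ¬ (d ≡ 0 [mod (suc (suc (suc p)) ^ suc n ∸ 1) ]) → ReversedPair (suc (suc (suc p))) (suc n) d
divisible-case p zero d d%p≡0 d≢0 =
  ⊥-elim (d≢0 (subst (λ m → d ≡ 0 [mod m ]) (sym modulus≡p) d%p≡0))
  where
  modulus≡p : suc (suc (suc p)) ^ 1 ∸ 1 ≡ suc (suc p)
  modulus≡p = trans (pow∸1≡*rep (suc (suc p)) 1) (*-identityʳ (suc (suc p)))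
divisible-case p (suc n) d d%p≡0 d≢0 =
  1 , 1 * R ,
  <-≤-trans (s≤s (s≤s z≤n)) (subst (suc (suc p) ≤_) (sym (pow∸1≡*rep (suc (suc p)) N))
                                   (m≤m*n (suc (suc p)) R)) ,
  word<modulus (suc (suc p)) (suc n) 1 (s≤s (s≤s z≤n)) ,
  (λ ()) , (λ eq → 0≢1+n (sym eq)) ,
  one-≺-rep (suc p) n ,
  subst (λ x → x ≺⟨ suc (suc (suc p)) , N ⟩ red (suc (suc (suc p))) N (d * 1))
        (sym dR≡0) (zero-≺ (suc (suc p)) N _ d≢0')
  where
  N = suc (suc n)
  R = rep (suc (suc (suc p))) N
  dR≡0 : red (suc (suc (suc p))) N (d * (1 * R)) ≡ 0
  dR≡0 = trans (red-*-word (suc (suc p)) (suc n) d 1)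
               (trans (cong (λ x → (x % suc (suc p)) * R) (*-identityʳ d)) (cong (_* R) d%p≡0))
  d≢0' : red (suc (suc (suc p))) N (d * 1) ≢ 0
  d≢0' eq = d≢0 (trans (cong (red (suc (suc (suc p))) N) (sym (*-identityʳ d)))
                       (trans eq (sym (zero-mod (suc (suc (suc p)) ^ N ∸ 1)))))

lemma6p7 : (t n d : ℕ) → 2 ≤ t → 1 ≤ n → 1 ≤ d →
    ¬ (d ≡ 0 [mod (t ^ n ∸ 1) ]) →
    ¬ (d ≡ 1 [mod (t ∸ 1) ]) →
    Σ ℕ λ a → Σ ℕ λ b →
    (a < t ^ n ∸ 1) × (b < t ^ n ∸ 1) × ¬ (a ≡ 0) × ¬ (b ≡ 0) ×
    (a ≺⟨ t , n ⟩ b) × (red t n (d * b) ≺⟨ t , n ⟩ red t n (d * a))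
lemma6p7 zero _ _ () _ _ _ _
lemma6p7 (suc zero) _ _ (s≤s ()) _ _ _ _
lemma6p7 (suc (suc zero)) n d _ _ _ _ d≢1 = ⊥-elim (d≢1 (n%1≡0 d))
lemma6p7 (suc (suc (suc p))) zero _ _ () _ _ _
lemma6p7 (suc (suc (suc p))) (suc n) d _ _ _ d≢0 d≢1 with d % suc (suc p) in d%p
... | zero          = divisible-case p n d d%p d≢0
... | suc zero      = ⊥-elim (d≢1 refl)
... | suc (suc _)   = nondivisible-case (suc p) n d (subst (2 ≤_) (sym d%p) (s≤s (s≤s z≤n)))
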